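{- Let $n\ge3$, let $\Phi=(\phi_n,\dots,\phi_3)$ with $\phi_j\in\mathcal S_{I_{j-1}}$, let $\mathfrak N$ be a $\big(\binom n2_{n-2}\,\binom n3_3\big)$-configuration with point set $\wp_2(I_n)$, and let $\mathfrak M=\Pi(n,\sigma_\Phi,\mathfrak N)$. Let $G$ be a set of points of $\mathfrak M$. The following are equivalent: (i) $G$ is the vertex set of a complete graph $K_{n+1}$ freely contained in $\mathfrak M$, and $G\neq A^\ast$, $G\ne B^\ast$; (ii) there is $i_0\in I_n$ such that the complete graph on $\{u\in\wp_2(I_n): i_0\in u\}$ is freely contained in $\mathfrak N$, $\phi_j(i_0)=i_0$ for all $j\in I_n$ with $i_0<j$, and $G=\{a_{i_0},b_{i_0}\}\cup\{c_u: i_0\in u\in\wp_2(I_n)\}$.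
   Context: $I_m=\{1,\dots,m\}$, $\wp_2(X)$ is the set of 2-subsets of $X$, $\mathcal S_X$ the permutations of $X$. A configuration is an incidence structure of points and lines (sets of points) in which two distinct lines share at most one point; a $\big(\binom n2_{n-2}\binom n3_3\big)$-configuration has $\binom n2$ points each on $n-2$ lines and $\binom n3$ lines each of size 3. Skew perspective: for $\sigma\in\mathcal S_{\wp_2(I_n)}$ and such a configuration $\mathfrak N$ on $\wp_2(I_n)$, $\Pi(n,\sigma,\mathfrak N)$ has pairwise distinct points $a_i,b_i$ ($i\in I_n$), $p$, $c_u$ ($u\in\wp_2(I_n)$) and lines $\{p,a_i,b_i\}$ ($i\in I_n$), $\{a_i,a_j,c_{\{i,j\}}\}$ and $\{b_i,b_j,c_{\sigma^{ -1}(\{i,j\})}\}$ ($\{i,j\}\in\wp_2(I_n)$), and $\{c_u,c_v,c_w\}$ for every line $\{u,v,w\}$ of $\mathfrak N$. Put $A^\ast=\{p,a_1,\dots,a_n\}$, $B^\ast=\{p,b_1,\dots,b_n\}$. For $\Phi=(\phi_n,\dots,\phi_3)$ with $\phi_j\in\mathcal S_{I_{j-1}}$ and $\phi_2=\mathrm{id}_{\{1\}}$, $\sigma_\Phi\in\mathcal S_{\wp_2(I_n)}$ is $\sigma_\Phi(\{i,j\})=\{j,\phi_j(i)\}$ for $1\le i<j\le n$. A complete graph on a point set $Y$ is freely contained in a configuration if every $e\in\wp_2(Y)$ lies on a line $\overline e$, the map $e\mapsto\overline e$ is injective, and lines $\overline e,\overline{e'}$ with $e\cap e'=\emptyset$ have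 no common point. -}

module Defs where

open import Data.Nat using (ℕ; suc; _∸_; _<_)
open import Data.Nat.Properties using (<⇒≤)
open import Data.Nat.Combinatorics using (_C_)
open import Data.Fin using (Fin; toℕ; inject≤; fromℕ<)
open import Data.Fin.Properties using (toℕ<n)
open import Data.Fin.Permutation using (Permutation′; _⟨$⟩ʳ_; _⟨$⟩ˡ_; inverseˡ; inverseʳ)
open import Data.Product using (Σ; ∃; _×_; _,_)
open import Data.Sum using (_⊎_)
open import Data.Empty using (⊥)
open import Relation.Nullary using (¬_)
open import Relation.Binary.PropositionalEquality using (_≡_; _≢_; refl; cong)
open import Function.Bundles using (_↔_; mk↔ₛ′; Inverse)

-- Conventions: I_n = {1,…,n} is represented by Fin n (0-indexed, so
-- the paper's index k corresponds to the Fin element with toℕ = k - 1).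

-- A 2-subset {i,j} (i < j) of Fin n, stored canonically by its larger
-- element hi = j and its smaller element lo = i as an element of
-- Fin (toℕ hi) = {0,…,hi-1}.
record P2 (n : ℕ) : Set where
  constructor ⟨_,_⟩
  field
    hi : Fin n
    lo : Fin (toℕ hi)

open P2 public

loF : ∀ {n} → P2 n → Fin n
loF u = inject≤ (lo u) (<⇒≤ (toℕ<n (hi u)))

_∈₂_ : ∀ {n} → Fin n → P2 n → Set
i ∈₂ u = i ≡ hi u ⊎ i ≡ loF u

HasSize : ∀ {A : Set} → (A → Set) → ℕ → Set
HasSize {A} Q k =
  Σ (Fin k → A) λ v →
    (∀ i j → v i ≡ v j → i ≡ j) × (∀ i → Q (v i)) × (∀ x → Q x → ∃ λ i → v i ≡ x)

_≐_ : ∀ {A : Set} → (A → Set) → (A → Set) → Set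
_≐_ {A} X Y = ∀ (x : A) → (X x → Y x) × (Y x → X x)

-- Incidence structures: points, line labels and incidence.  In the
-- structures used below distinct labels always denote distinct point
-- sets, so labels can be identified with lines.

record Structure : Set₁ where
  field
    Point : Set
    Line  : Set
    _I_   : Point → Line → Set

-- A complete graph on the point set Y is freely contained in S:
-- f x y is the line ē of the edge e = {x,y}.
FreelyContains : (S : Structure) → (Structure.Point S → Set) → Set
FreelyContains S Y =
  Σ (Point → Point → Line) λ f →
      (∀ x y → Y x → Y y → x ≢ y → f x y ≡ f y x)
    × (∀ x y → Y x → Y y → x ≢ y → (x I f x y) × (y I f x y))
    × (∀ x y x' y' → Y x → Y y → Y x' → Y y' → x ≢ y → x' ≢ y' →
         f x y ≡ f x' y' → (x ≡ x' × y ≡ y') ⊎ (x ≡ y' × y ≡ x'))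
    × (∀ x y x' y' → Y x → Y y → Y x' → Y y' → x ≢ y → x' ≢ y' →
         x ≢ x' → x ≢ y' → y ≢ x' → y ≢ y' →
         ∀ z → z I f x y → z I f x' y' → ⊥)
  where open Structure S

-- A ((n choose 2)_{n-2} (n choose 3)_3)-configuration with point set
-- ℘₂(I_n): binom(n,3) lines (labelled by Fin (n C 3)), each a set of
-- three distinct points; two distinct lines share at most one point
-- (in particular distinct labels give distinct lines); every point
-- lies on exactly n-2 lines.

record Config (n : ℕ) : Set where
  field
    pt₁ pt₂ pt₃ : Fin (n C 3) → P2 n
  _∈L_ : P2 n → Fin (n C 3) → Set
  u ∈L l = u ≡ pt₁ l ⊎ u ≡ pt₂ l ⊎ u ≡ pt₃ l
  field
    distinct₁₂ : ∀ l → pt₁ l ≢ pt₂ l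
    distinct₁₃ : ∀ l → pt₁ l ≢ pt₃ l
    distinct₂₃ : ∀ l → pt₂ l ≢ pt₃ l
    meet≤1 : ∀ l l' → l ≢ l' → ∀ u v → u ≢ v →
             u ∈L l → v ∈L l → u ∈L l' → v ∈L l' → ⊥
    degree : ∀ u → HasSize (λ l → u ∈L l) (n ∸ 2)

ConfigStructure : ∀ {n} → Config n → Structure
ConfigStructure {n} N = record { Point = P2 n ; Line = Fin (n C 3) ; _I_ = Config._∈L_ N }

data Pt (n : ℕ) : Set where
  p : Pt n
  a : Fin n → Pt n
  b : Fin n → Pt n
  c : P2 n → Pt n

data PiLine (n : ℕ) : Set where
  lP : Fin n → PiLine n
  lA : P2 n → PiLine n
  lB : P2 n → PiLine n
  lC : Fin (n C 3) → PiLine n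

module _ {n : ℕ} (σ : P2 n ↔ P2 n) (N : Config n) where
  open Config N

  PiInc : Pt n → PiLine n → Set
  PiInc x (lP i) = x ≡ p ⊎ x ≡ a i ⊎ x ≡ b i
  PiInc x (lA u) = x ≡ a (hi u) ⊎ x ≡ a (loF u) ⊎ x ≡ c u
  PiInc x (lB u) = x ≡ b (hi u) ⊎ x ≡ b (loF u) ⊎ x ≡ c (Inverse.from σ u)
  PiInc x (lC l) = x ≡ c (pt₁ l) ⊎ x ≡ c (pt₂ l) ⊎ x ≡ c (pt₃ l)

  Π : Structure
  Π = record { Point = Pt n ; Line = PiLine n ; _I_ = PiInc }

A* : ∀ {n} → Pt n → Set
A* {n} x = x ≡ p ⊎ Σ (Fin n) λ i → x ≡ a i

B* : ∀ {n} → Pt n → Set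
B* {n} x = x ≡ p ⊎ Σ (Fin n) λ i → x ≡ b i

-- Φ = (φ_n, …, φ_3), φ_j ∈ S_{I_{j-1}}.  0-indexed: for j : Fin n
-- (paper's index toℕ j + 1), φ j permutes Fin (toℕ j) (= paper's
-- I_{j-1}).  The components with toℕ j ∈ {0,1} (paper's φ_1 on ∅ and
-- φ_2 = id_{1}) are permutations of Fin 0 / Fin 1, hence forced.

Perms : ℕ → Set
Perms n = (j : Fin n) → Permutation′ (toℕ j)

σΦ : ∀ {n} → Perms n → P2 n ↔ P2 n
σΦ Φ = mk↔ₛ′
  (λ u → ⟨ hi u , Φ (hi u) ⟨$⟩ʳ lo u ⟩)
  (λ u → ⟨ hi u , Φ (hi u) ⟨$⟩ˡ lo u ⟩)
  (λ u → cong ⟨ hi u ,_⟩ (inverseʳ (Φ (hi u))))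
  (λ u → cong ⟨ hi u ,_⟩ (inverseˡ (Φ (hi u))))

module Submission where

-- Every vertex x of a freely contained K_{n+1} lies on n pairwise distinct edge lines, which
-- rules out x whenever fewer than n lines through x can carry its edges.  If p ∈ G, the edges at
-- p lie on the lines {p, a_k, b_k}, so G ⊆ A* ∪ B*; a_i and b_j cannot both be in G (the edge
-- a_i b_j forces i = j, and then p a_i and p b_i would share a line), so by counting G is A* or
-- B*.  If p ∉ G, a vertex a_i keeps only the n − 1 lines {a_i, a_j, c_ij} unless b_i ∈ G, and
-- symmetrically for b_i, while a vertex c_u surrounded by points c_w keeps only the n − 2 lines of 𝔑.
-- Hence a_i, b_i ∈ G, every other vertex c_u is joined to a_i, so i ∈ u, and counting gives
-- G = {a_i, b_i} ∪ {c_u : i ∈ u}.  The edges c_u c_v lie on lines of 𝔑, so the star of i is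
-- freely contained in 𝔑, and the edge c_u b_i lies on {b_i, b_j, c_σ⁻¹{i,j}}, so σ maps the star
-- of i into itself, which for σ = σ_Φ says φ_j(i) = i for j > i.  Conversely these conditions
-- give a line for each pair of vertices, and two lines of disjoint edges could only meet in a
-- third vertex c_w on a line of 𝔑 through c_u and c_v, which free containment in 𝔑 forbids.

open import Defs
open import Data.Nat using (ℕ; suc; _≤_; _<_; _+_; s≤s; s≤s⁻¹)
open import Data.Nat.Properties using (1+n≰n; <-irrefl; <-asym; n≤1+n; ≤-trans)
open import Data.Nat.Combinatorics using (_C_)
open import Data.Fin as Fin using (Fin; toℕ; fromℕ<; punchIn; punchOut)
open import Data.Fin.Properties using (toℕ-injective; toℕ-fromℕ<; toℕ-inject≤; toℕ<n; injective⇒≤;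
  punchIn-injective; punchOut-injective; punchInᵢ≢i; punchIn-punchOut; <-cmp; any?)
open import Data.Fin.Permutation using (_⟨$⟩ʳ_)
open import Data.Vec.Functional using (_∷_)
open import Data.Product as Product using (Σ; ∃; _×_; _,_; proj₁; proj₂; uncurry)
open import Data.Sum as Sum using (_⊎_; inj₁; inj₂; [_,_])
open import Data.Empty using (⊥; ⊥-elim)
open import Relation.Nullary using (¬_; yes; no)
open import Relation.Nullary.Decidable using (map′; decidable-stable)
open import Relation.Unary using (Decidable)
open import Relation.Binary.Definitions using (DecidableEquality; tri<; tri≈; tri>)
open import Relation.Binary.PropositionalEquality using (_≡_; _≢_; refl; sym; trans; cong; subst; subst₂; ≢-sym)
open import Function using (_∘_)
open import Function.Bundles using (_⇔_; _↔_; Inverse; Equivalence; mk⇔)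
open import Function.Definitions using (Injective)

-- Counting in finite sets

injective-endo⇒surjective : ∀ {m} (g : Fin m → Fin m) → Injective _≡_ _≡_ g →
                             ∀ r → ∃ λ t → g t ≡ r
injective-endo⇒surjective {suc m} g g-injective r with any? (λ t → g t Fin.≟ r)
... | yes hit  = hit
... | no  miss = ⊥-elim (1+n≰n (injective⇒≤ g∖r-injective))
  where
  r≢g : ∀ t → r ≢ g t
  r≢g t r≡gt = miss (t , sym r≡gt)

  g∖r : Fin (suc m) → Fin m
  g∖r t = punchOut (r≢g t)

  g∖r-injective : Injective _≡_ _≡_ g∖r
  g∖r-injective {s} {t} eq = g-injective (punchOut-injective (r≢g s) (r≢g t) eq)

module _ {A : Set} where

  private
    position-injective : ∀ {m k} {v : Fin m → A} {w : Fin k → A} →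
                         (∀ s t → v s ≡ v t → s ≡ t) → (cover : ∀ t → ∃ λ r → w r ≡ v t) →
                         Injective _≡_ _≡_ (proj₁ ∘ cover)
    position-injective {w = w} v-injective cover {s} {t} eq =
      v-injective s t (trans (sym (proj₂ (cover s))) (trans (cong w eq) (proj₂ (cover t))))

  covered-injection⇒≤ : ∀ {m k} (v : Fin m → A) → (∀ s t → v s ≡ v t → s ≡ t) →
                        (w : Fin k → A) → (∀ t → ∃ λ r → w r ≡ v t) → m ≤ k
  covered-injection⇒≤ v v-injective w cover = injective⇒≤ (position-injective v-injective cover)

  ⊆∧covered⇒≐ : ∀ {m} {G Q : A → Set} → HasSize G m → (w : Fin m → A) →
                (∀ x → Q x → ∃ λ r → w r ≡ x) → (∀ x → G x → Q x) → G ≐ Q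
  ⊆∧covered⇒≐ {G = G} {Q} (v , v-injective , v∈G , _) w Q⊆w G⊆Q x = G⊆Q x , Q⊆G
    where
    cover : ∀ t → ∃ λ r → w r ≡ v t
    cover t = Q⊆w (v t) (G⊆Q (v t) (v∈G t))

    Q⊆G : Q x → G x
    Q⊆G x∈Q =
      let r , wr≡x = Q⊆w x x∈Q
          t , position≡r = injective-endo⇒surjective (proj₁ ∘ cover) (position-injective v-injective cover) r
      in subst G (trans (sym (proj₂ (cover t))) (trans (cong w position≡r) wr≡x)) (v∈G t)

  HasSize⇒decidable : ∀ {m} {G : A → Set} → DecidableEquality A → HasSize G m → Decidable G
  HasSize⇒decidable {G = G} _≟_ (v , _ , v∈G , onto) x =
    map′ (λ (r , vr≡x) → subst G vr≡x (v∈G r)) (onto x) (any? λ r → v r ≟ x)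

  HasSize-resp-≐ : ∀ {m} {G H : A → Set} → G ≐ H → HasSize G m → HasSize H m
  HasSize-resp-≐ G≐H (v , v-injective , v∈G , onto) =
    v , v-injective , (λ t → proj₁ (G≐H (v t)) (v∈G t)) , λ x x∈H → onto x (proj₂ (G≐H x) x∈H)

module _ {A : Set} where

  SamePair : A → A → A → A → Set
  SamePair x y x′ y′ = (x ≡ x′ × y ≡ y′) ⊎ (x ≡ y′ × y ≡ x′)

  Disjoint : A → A → A → A → Set
  Disjoint x y x′ y′ = x ≢ x′ × x ≢ y′ × y ≢ x′ × y ≢ y′

  SamePair-sym : ∀ {x y x′ y′} → SamePair x y x′ y′ → SamePair x′ y′ x y
  SamePair-sym (inj₁ (refl , refl)) = inj₁ (refl , refl)
  SamePair-sym (inj₂ (refl , refl)) = inj₂ (refl , refl)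

  SamePair-trans : ∀ {x y x′ y′ x″ y″} → SamePair x y x′ y′ → SamePair x′ y′ x″ y″ → SamePair x y x″ y″
  SamePair-trans (inj₁ (refl , refl)) same = same
  SamePair-trans (inj₂ (refl , refl)) (inj₁ (refl , refl)) = inj₂ (refl , refl)
  SamePair-trans (inj₂ (refl , refl)) (inj₂ (refl , refl)) = inj₁ (refl , refl)

  Disjoint-resp-SamePair : ∀ {x y x′ y′ d₁ d₂ d₁′ d₂′} → SamePair x y d₁ d₂ → SamePair x′ y′ d₁′ d₂′ →
                           Disjoint x y x′ y′ → Disjoint d₁ d₂ d₁′ d₂′
  Disjoint-resp-SamePair (inj₁ (refl , refl)) (inj₁ (refl , refl)) (n₁ , n₂ , n₃ , n₄) = n₁ , n₂ , n₃ , n₄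
  Disjoint-resp-SamePair (inj₁ (refl , refl)) (inj₂ (refl , refl)) (n₁ , n₂ , n₃ , n₄) = n₂ , n₁ , n₄ , n₃
  Disjoint-resp-SamePair (inj₂ (refl , refl)) (inj₁ (refl , refl)) (n₁ , n₂ , n₃ , n₄) = n₃ , n₄ , n₁ , n₂
  Disjoint-resp-SamePair (inj₂ (refl , refl)) (inj₂ (refl , refl)) (n₁ , n₂ , n₃ , n₄) = n₄ , n₃ , n₂ , n₁

module _ {A B : Set} (f : A → B) where

  SamePair-map : ∀ {x y x′ y′} → SamePair x y x′ y′ → SamePair (f x) (f y) (f x′) (f y′)
  SamePair-map = Sum.map (Product.map (cong f) (cong f)) (Product.map (cong f) (cong f))

  SamePair-map⁻¹ : Injective _≡_ _≡_ f →
                   ∀ {x y x′ y′} → SamePair (f x) (f y) (f x′) (f y′) → SamePair x y x′ y′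
  SamePair-map⁻¹ f-injective = Sum.map (Product.map f-injective f-injective) (Product.map f-injective f-injective)

  Disjoint-map⁻¹ : ∀ {x y x′ y′} → Disjoint (f x) (f y) (f x′) (f y′) → Disjoint x y x′ y′
  Disjoint-map⁻¹ (n₁ , n₂ , n₃ , n₄) = n₁ ∘ cong f , n₂ ∘ cong f , n₃ ∘ cong f , n₄ ∘ cong f

-- Complete graphs freely contained in incidence structures

IsPartialLinear : Structure → Set
IsPartialLinear S = ∀ L L′ → L ≢ L′ → ∀ x y → x ≢ y → x I L → y I L → x I L′ → y I L′ → ⊥
  where open Structure S

module FreeGraph (S : Structure) {Y : Structure.Point S → Set} (free : FreelyContains S Y) where
  open Structure S

  edge-line : Point → Point → Line
  edge-line = proj₁ free

  edge-line-sym : ∀ x y → Y x → Y y → x ≢ y → edge-line x y ≡ edge-line y x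
  edge-line-sym = proj₁ (proj₂ free)

  edge-line-incident : ∀ x y → Y x → Y y → x ≢ y → x I edge-line x y × y I edge-line x y
  edge-line-incident = proj₁ (proj₂ (proj₂ free))

  edge-line-injective : ∀ x y x′ y′ → Y x → Y y → Y x′ → Y y′ → x ≢ y → x′ ≢ y′ →
                        edge-line x y ≡ edge-line x′ y′ → SamePair x y x′ y′
  edge-line-injective = proj₁ (proj₂ (proj₂ (proj₂ free)))

  edge-lines-disjoint : ∀ x y x′ y′ → Y x → Y y → Y x′ → Y y′ → x ≢ y → x′ ≢ y′ →
                        Disjoint x y x′ y′ → ∀ z → z I edge-line x y → z I edge-line x′ y′ → ⊥
  edge-lines-disjoint x y x′ y′ x∈Y y∈Y x′∈Y y′∈Y x≢y x′≢y′ (n₁ , n₂ , n₃ , n₄) =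
    proj₂ (proj₂ (proj₂ (proj₂ free))) x y x′ y′ x∈Y y∈Y x′∈Y y′∈Y x≢y x′≢y′ n₁ n₂ n₃ n₄

  edge-lines-covered⇒≤ : ∀ {d k x} → HasSize Y (suc d) → Y x → (w : Fin k → Line) →
    (∀ y → Y y → y ≢ x → x I edge-line x y → y I edge-line x y → ∃ λ r → w r ≡ edge-line x y) →
    d ≤ k
  edge-lines-covered⇒≤ {d} {x = x} (v , v-injective , v∈Y , onto) x∈Y w cover with onto x x∈Y
  ... | t₀ , refl = covered-injection⇒≤ line-to line-to-injective w cover′
    where
    neighbour : Fin d → Point
    neighbour s = v (punchIn t₀ s)

    neighbour≢ : ∀ s → v t₀ ≢ neighbour s
    neighbour≢ s eq = punchInᵢ≢i t₀ s (sym (v-injective _ _ eq))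

    line-to : Fin d → Line
    line-to s = edge-line (v t₀) (neighbour s)

    line-to-injective : ∀ s s′ → line-to s ≡ line-to s′ → s ≡ s′
    line-to-injective s s′ eq
      with edge-line-injective _ _ _ _ x∈Y (v∈Y _) x∈Y (v∈Y _) (neighbour≢ s) (neighbour≢ s′) eq
    ... | inj₁ (_ , same) = punchIn-injective t₀ s s′ (v-injective _ _ same)
    ... | inj₂ (t₀≡ , _) = ⊥-elim (neighbour≢ s′ t₀≡)

    cover′ : ∀ s → ∃ λ r → w r ≡ line-to s
    cover′ s = uncurry (cover (neighbour s) (v∈Y _) (≢-sym (neighbour≢ s)))
                       (edge-line-incident _ _ x∈Y (v∈Y _) (neighbour≢ s))

  third-vertex-not-on-edge-line : IsPartialLinear S → ∀ {x y z} → Y x → Y y → Y z →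
                                  x ≢ y → z ≢ x → z ≢ y → ¬ (z I edge-line x y)
  third-vertex-not-on-edge-line linear {x} {y} {z} x∈Y y∈Y z∈Y x≢y z≢x z≢y z∈xy =
    linear (edge-line x y) (edge-line x z) xy≢xz x z (≢-sym z≢x)
           (proj₁ (edge-line-incident x y x∈Y y∈Y x≢y)) z∈xy
           (proj₁ xz-incident) (proj₂ xz-incident)
    where
    xz-incident : x I edge-line x z × z I edge-line x z
    xz-incident = edge-line-incident x z x∈Y z∈Y (≢-sym z≢x)

    xy≢xz : edge-line x y ≢ edge-line x z
    xy≢xz eq with edge-line-injective x y x z x∈Y y∈Y x∈Y z∈Y x≢y (≢-sym z≢x) eq
    ... | inj₁ (_ , y≡z) = z≢y (sym y≡z)
    ... | inj₂ (x≡z , _) = z≢x (sym x≡z)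

module _ (S : Structure) where
  open Structure S

  FreelyContains-⊆ : ∀ {Y Z : Point → Set} → (∀ {x} → Z x → Y x) → FreelyContains S Y → FreelyContains S Z
  FreelyContains-⊆ Z⊆Y (f , f-sym , f-incident , f-injective , f-disjoint) =
    f ,
    (λ x y x∈ y∈ → f-sym x y (Z⊆Y x∈) (Z⊆Y y∈)) ,
    (λ x y x∈ y∈ → f-incident x y (Z⊆Y x∈) (Z⊆Y y∈)) ,
    (λ x y x′ y′ x∈ y∈ x′∈ y′∈ → f-injective x y x′ y′ (Z⊆Y x∈) (Z⊆Y y∈) (Z⊆Y x′∈) (Z⊆Y y′∈)) ,
    (λ x y x′ y′ x∈ y∈ x′∈ y′∈ → f-disjoint x y x′ y′ (Z⊆Y x∈) (Z⊆Y y∈) (Z⊆Y x′∈) (Z⊆Y y′∈))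

  FreelyContains-by-edges :
    ∀ {Y : Point → Set} {E : Set} (end₁ end₂ : E → Point) (line : E → Line) (f : Point → Point → Line) →
    (∀ x y → Y x → Y y → x ≢ y → f x y ≡ f y x) →
    (∀ {x y} → Y x → Y y → x ≢ y → Σ E λ e → f x y ≡ line e × SamePair x y (end₁ e) (end₂ e)) →
    (∀ e → end₁ e I line e × end₂ e I line e) →
    (∀ e e′ → line e ≡ line e′ → SamePair (end₁ e) (end₂ e) (end₁ e′) (end₂ e′)) →
    (∀ e e′ → Disjoint (end₁ e) (end₂ e) (end₁ e′) (end₂ e′) → ∀ z → z I line e → z I line e′ → ⊥) →
    FreelyContains S Y
  FreelyContains-by-edges {Y} end₁ end₂ line f f-sym edge ends-incident line-injective lines-disjoint =
    f , f-sym , f-incident , f-injective , f-disjoint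
    where
    f-incident : ∀ x y → Y x → Y y → x ≢ y → x I f x y × y I f x y
    f-incident x y x∈Y y∈Y x≢y with edge x∈Y y∈Y x≢y
    ... | e , f≡ , inj₁ (refl , refl) = subst (λ L → x I L × y I L) (sym f≡) (ends-incident e)
    ... | e , f≡ , inj₂ (refl , refl) = subst (λ L → x I L × y I L) (sym f≡) (Product.swap (ends-incident e))

    f-injective : ∀ x y x′ y′ → Y x → Y y → Y x′ → Y y′ → x ≢ y → x′ ≢ y′ →
                  f x y ≡ f x′ y′ → SamePair x y x′ y′
    f-injective x y x′ y′ x∈Y y∈Y x′∈Y y′∈Y x≢y x′≢y′ eq
      with edge x∈Y y∈Y x≢y | edge x′∈Y y′∈Y x′≢y′
    ... | e , f≡ , xy~e | e′ , f≡′ , x′y′~e′ =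
      SamePair-trans xy~e (SamePair-trans (line-injective e e′ (trans (sym f≡) (trans eq f≡′)))
                                          (SamePair-sym x′y′~e′))

    f-disjoint : ∀ x y x′ y′ → Y x → Y y → Y x′ → Y y′ → x ≢ y → x′ ≢ y′ →
                 x ≢ x′ → x ≢ y′ → y ≢ x′ → y ≢ y′ → ∀ z → z I f x y → z I f x′ y′ → ⊥
    f-disjoint x y x′ y′ x∈Y y∈Y x′∈Y y′∈Y x≢y x′≢y′ n₁ n₂ n₃ n₄ z z∈xy z∈x′y′
      with edge x∈Y y∈Y x≢y | edge x′∈Y y′∈Y x′≢y′
    ... | e , f≡ , xy~e | e′ , f≡′ , x′y′~e′ =
      lines-disjoint e e′ (Disjoint-resp-SamePair xy~e x′y′~e′ (n₁ , n₂ , n₃ , n₄)) z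
                     (subst (z I_) f≡ z∈xy) (subst (z I_) f≡′ z∈x′y′)

module _ (S T : Structure) where
  private
    module S = Structure S
    module T = Structure T

  FreelyContains-pullback :
    ∀ {Y : S.Point → Set} {Z : T.Point → Set}
    (e : S.Point → T.Point) (ℓ : S.Line → T.Line) (ℓ⁻ : T.Line → S.Line) →
    Injective _≡_ _≡_ e →
    (∀ {x L} → x S.I L → e x T.I ℓ L) →
    (∀ {x L} → e x T.I ℓ L → x S.I L) →
    (∀ {x} → Y x → Z (e x)) →
    (free : FreelyContains T Z) →
    (∀ x y → Y x → Y y → x ≢ y →
       ℓ (ℓ⁻ (FreeGraph.edge-line T free (e x) (e y))) ≡ FreeGraph.edge-line T free (e x) (e y)) →
    FreelyContains S Y
  FreelyContains-pullback {Y} e ℓ ℓ⁻ e-injective preserves reflects Y⇒Z free through-ℓ =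
    f , f-sym , f-incident , f-injective , f-disjoint
    where
    open FreeGraph T free

    e≢ : ∀ {x y} → x ≢ y → e x ≢ e y
    e≢ x≢y = x≢y ∘ e-injective

    f : S.Point → S.Point → S.Line
    f x y = ℓ⁻ (edge-line (e x) (e y))

    onto-f : ∀ {x y z} → Y x → Y y → x ≢ y → e z T.I edge-line (e x) (e y) → z S.I f x y
    onto-f {x} {y} {z} x∈Y y∈Y x≢y = reflects ∘ subst (λ L → e z T.I L) (sym (through-ℓ x y x∈Y y∈Y x≢y))

    from-f : ∀ {x y z} → Y x → Y y → x ≢ y → z S.I f x y → e z T.I edge-line (e x) (e y)
    from-f {x} {y} {z} x∈Y y∈Y x≢y = subst (λ L → e z T.I L) (through-ℓ x y x∈Y y∈Y x≢y) ∘ preserves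

    f-sym : ∀ x y → Y x → Y y → x ≢ y → f x y ≡ f y x
    f-sym x y x∈Y y∈Y x≢y = cong ℓ⁻ (edge-line-sym (e x) (e y) (Y⇒Z x∈Y) (Y⇒Z y∈Y) (e≢ x≢y))

    f-incident : ∀ x y → Y x → Y y → x ≢ y → x S.I f x y × y S.I f x y
    f-incident x y x∈Y y∈Y x≢y =
      Product.map (onto-f x∈Y y∈Y x≢y) (onto-f x∈Y y∈Y x≢y)
                  (edge-line-incident (e x) (e y) (Y⇒Z x∈Y) (Y⇒Z y∈Y) (e≢ x≢y))

    f-injective : ∀ x y x′ y′ → Y x → Y y → Y x′ → Y y′ → x ≢ y → x′ ≢ y′ →
                  f x y ≡ f x′ y′ → SamePair x y x′ y′
    f-injective x y x′ y′ x∈Y y∈Y x′∈Y y′∈Y x≢y x′≢y′ eq =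
      SamePair-map⁻¹ e e-injective
        (edge-line-injective _ _ _ _ (Y⇒Z x∈Y) (Y⇒Z y∈Y) (Y⇒Z x′∈Y) (Y⇒Z y′∈Y) (e≢ x≢y) (e≢ x′≢y′)
          (trans (sym (through-ℓ x y x∈Y y∈Y x≢y)) (trans (cong ℓ eq) (through-ℓ x′ y′ x′∈Y y′∈Y x′≢y′))))

    f-disjoint : ∀ x y x′ y′ → Y x → Y y → Y x′ → Y y′ → x ≢ y → x′ ≢ y′ →
                 x ≢ x′ → x ≢ y′ → y ≢ x′ → y ≢ y′ → ∀ z → z S.I f x y → z S.I f x′ y′ → ⊥
    f-disjoint x y x′ y′ x∈Y y∈Y x′∈Y y′∈Y x≢y x′≢y′ n₁ n₂ n₃ n₄ z z∈xy z∈x′y′ =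
      edge-lines-disjoint _ _ _ _ (Y⇒Z x∈Y) (Y⇒Z y∈Y) (Y⇒Z x′∈Y) (Y⇒Z y′∈Y) (e≢ x≢y) (e≢ x′≢y′)
        (e≢ n₁ , e≢ n₂ , e≢ n₃ , e≢ n₄) (e z) (from-f x∈Y y∈Y x≢y z∈xy) (from-f x′∈Y y′∈Y x′≢y′ z∈x′y′)

-- Two-element subsets of Fin n

module _ {n : ℕ} where

  toℕ-loF : (u : P2 n) → toℕ (loF u) ≡ toℕ (lo u)
  toℕ-loF u = toℕ-inject≤ (lo u) _

  loF<hi : (u : P2 n) → toℕ (loF u) < toℕ (hi u)
  loF<hi u = subst (_< toℕ (hi u)) (sym (toℕ-loF u)) (toℕ<n (lo u))

  ≡loF⇔ : ∀ {i : Fin n} {u} → i ≡ loF u ⇔ toℕ i ≡ toℕ (lo u)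
  ≡loF⇔ {u = u} = mk⇔ (λ i≡ → trans (cong toℕ i≡) (toℕ-loF u))
                      (λ i≡ → toℕ-injective (trans i≡ (sym (toℕ-loF u))))

  P2-≡ : ∀ {u w : P2 n} → hi u ≡ hi w → loF u ≡ loF w → u ≡ w
  P2-≡ {⟨ h , l ⟩} {⟨ .h , l′ ⟩} refl loF≡ =
    cong ⟨ h ,_⟩ (toℕ-injective (trans (sym (toℕ-loF ⟨ h , l ⟩)) (Equivalence.to ≡loF⇔ loF≡)))

  _≟₂_ : DecidableEquality (P2 n)
  ⟨ h , l ⟩ ≟₂ ⟨ h′ , l′ ⟩ with h Fin.≟ h′
  ... | no h≢h′ = no (h≢h′ ∘ cong hi)
  ... | yes refl = map′ (cong ⟨ h ,_⟩) (λ { refl → refl }) (l Fin.≟ l′)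

  pair : (i j : Fin n) → i ≢ j → P2 n
  pair i j i≢j with <-cmp i j
  ... | tri< i<j _ _ = ⟨ j , fromℕ< i<j ⟩
  ... | tri≈ _ i≡j _ = ⊥-elim (i≢j i≡j)
  ... | tri> _ _ j<i = ⟨ i , fromℕ< j<i ⟩

  loF-fromℕ< : ∀ {i j : Fin n} (i<j : toℕ i < toℕ j) → i ≡ loF ⟨ j , fromℕ< i<j ⟩
  loF-fromℕ< i<j = Equivalence.from ≡loF⇔ (sym (toℕ-fromℕ< i<j))

  ∈₂-pair : ∀ i j (i≢j : i ≢ j) → i ∈₂ pair i j i≢j × j ∈₂ pair i j i≢j
  ∈₂-pair i j i≢j with <-cmp i j
  ... | tri< i<j _ _ = inj₂ (loF-fromℕ< i<j) , inj₁ refl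
  ... | tri≈ _ i≡j _ = ⊥-elim (i≢j i≡j)
  ... | tri> _ _ j<i = inj₁ refl , inj₂ (loF-fromℕ< j<i)

  ∈₂-at-most-two : ∀ {i j k : Fin n} {u} → i ≢ j → i ∈₂ u → j ∈₂ u → k ∈₂ u → k ≡ i ⊎ k ≡ j
  ∈₂-at-most-two i≢j (inj₁ refl) (inj₁ refl) _ = ⊥-elim (i≢j refl)
  ∈₂-at-most-two i≢j (inj₂ refl) (inj₂ refl) _ = ⊥-elim (i≢j refl)
  ∈₂-at-most-two _ (inj₁ refl) (inj₂ refl) (inj₁ refl) = inj₁ refl
  ∈₂-at-most-two _ (inj₁ refl) (inj₂ refl) (inj₂ refl) = inj₂ refl
  ∈₂-at-most-two _ (inj₂ refl) (inj₁ refl) (inj₁ refl) = inj₂ refl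
  ∈₂-at-most-two _ (inj₂ refl) (inj₁ refl) (inj₂ refl) = inj₁ refl

  two-members⇒≡ : ∀ {i j : Fin n} {u w} → i ≢ j → i ∈₂ u → j ∈₂ u → i ∈₂ w → j ∈₂ w → u ≡ w
  two-members⇒≡ i≢j (inj₁ i≡) (inj₁ j≡) _ _ = ⊥-elim (i≢j (trans i≡ (sym j≡)))
  two-members⇒≡ i≢j (inj₂ i≡) (inj₂ j≡) _ _ = ⊥-elim (i≢j (trans i≡ (sym j≡)))
  two-members⇒≡ i≢j _ _ (inj₁ i≡) (inj₁ j≡) = ⊥-elim (i≢j (trans i≡ (sym j≡)))
  two-members⇒≡ i≢j _ _ (inj₂ i≡) (inj₂ j≡) = ⊥-elim (i≢j (trans i≡ (sym j≡)))
  two-members⇒≡ _ (inj₁ i≡) (inj₂ j≡) (inj₁ i≡′) (inj₂ j≡′) = P2-≡ (trans (sym i≡) i≡′) (trans (sym j≡) j≡′)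
  two-members⇒≡ _ (inj₂ i≡) (inj₁ j≡) (inj₂ i≡′) (inj₁ j≡′) = P2-≡ (trans (sym j≡) j≡′) (trans (sym i≡) i≡′)
  two-members⇒≡ {u = u} {w} _ (inj₁ refl) (inj₂ refl) (inj₂ hu≡) (inj₁ lu≡) =
    ⊥-elim (<-asym (loF<hi u) (subst₂ _<_ (cong toℕ (sym hu≡)) (cong toℕ (sym lu≡)) (loF<hi w)))
  two-members⇒≡ {u = u} {w} _ (inj₂ refl) (inj₁ refl) (inj₁ lu≡) (inj₂ hu≡) =
    ⊥-elim (<-asym (loF<hi u) (subst₂ _<_ (cong toℕ (sym hu≡)) (cong toℕ (sym lu≡)) (loF<hi w)))

  partner : ∀ {i : Fin n} {u} → i ∈₂ u → Σ (Fin n) λ j → i ≢ j × j ∈₂ u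
  partner {u = u} (inj₁ refl) = loF u , (λ hi≡lo → <-irrefl (cong toℕ (sym hi≡lo)) (loF<hi u)) , inj₂ refl
  partner {u = u} (inj₂ refl) = hi u , (λ lo≡hi → <-irrefl (cong toℕ lo≡hi) (loF<hi u)) , inj₁ refl

module _ {n : ℕ} (i : Fin (suc n)) where

  star : Fin n → P2 (suc n)
  star s = pair i (punchIn i s) (≢-sym (punchInᵢ≢i i s))

  i∈₂star : ∀ s → i ∈₂ star s
  i∈₂star s = proj₁ (∈₂-pair i _ _)

  punchIn∈₂star : ∀ s → punchIn i s ∈₂ star s
  punchIn∈₂star s = proj₂ (∈₂-pair i _ _)

  star-injective : ∀ s s′ → star s ≡ star s′ → s ≡ s′
  star-injective s s′ eq =
    [ ⊥-elim ∘ punchInᵢ≢i i s , punchIn-injective i s s′ ]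
      (∈₂-at-most-two (≢-sym (punchInᵢ≢i i s′)) (i∈₂star s′) (punchIn∈₂star s′)
                      (subst (punchIn i s ∈₂_) eq (punchIn∈₂star s)))

  star-onto : ∀ {u} → i ∈₂ u → ∃ λ s → star s ≡ u
  star-onto i∈u with partner i∈u
  ... | j , i≢j , j∈u = punchOut i≢j , two-members⇒≡ i≢j (i∈₂star _) j∈star i∈u j∈u
    where
    j∈star : j ∈₂ star (punchOut i≢j)
    j∈star = subst (_∈₂ star (punchOut i≢j)) (punchIn-punchOut i≢j) (punchIn∈₂star _)

-- Points and incidences of the skew perspective

c-injective : ∀ {n} → Injective _≡_ _≡_ (c {n})
c-injective refl = refl

_≟ₚ_ : ∀ {n} → DecidableEquality (Pt n)
p ≟ₚ p = yes refl
a i ≟ₚ a j = map′ (cong a) (λ { refl → refl }) (i Fin.≟ j)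
b i ≟ₚ b j = map′ (cong b) (λ { refl → refl }) (i Fin.≟ j)
c u ≟ₚ c w = map′ (cong c) c-injective (u ≟₂ w)
p ≟ₚ a _ = no λ ()
p ≟ₚ b _ = no λ ()
p ≟ₚ c _ = no λ ()
a _ ≟ₚ p = no λ ()
a _ ≟ₚ b _ = no λ ()
a _ ≟ₚ c _ = no λ ()
b _ ≟ₚ p = no λ ()
b _ ≟ₚ a _ = no λ ()
b _ ≟ₚ c _ = no λ ()
c _ ≟ₚ p = no λ ()
c _ ≟ₚ a _ = no λ ()
c _ ≟ₚ b _ = no λ ()

module Incidence {n : ℕ} (σ : P2 n ↔ P2 n) (N : Config n) where
  open Config N using (_∈L_)

  _I_ : Pt n → PiLine n → Set
  _I_ = PiInc σ N

  to from : P2 n → P2 n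
  to = Inverse.to σ
  from = Inverse.from σ

  from-to : ∀ u → from (to u) ≡ u
  from-to = Inverse.strictlyInverseʳ σ

  to-from : ∀ w → to (from w) ≡ w
  to-from = Inverse.strictlyInverseˡ σ

  -- PiInc with its defining equations solved, so that matching on On x L discards the
  -- impossible incidences by unification.
  data On : Pt n → PiLine n → Set where
    p-on-lP : ∀ {k} → On p (lP k)
    a-on-lP : ∀ {k} → On (a k) (lP k)
    b-on-lP : ∀ {k} → On (b k) (lP k)
    a-on-lA : ∀ {i u} → i ∈₂ u → On (a i) (lA u)
    c-on-lA : ∀ {u} → On (c u) (lA u)
    b-on-lB : ∀ {i w} → i ∈₂ w → On (b i) (lB w)
    c-on-lB : ∀ {u w} → from w ≡ u → On (c u) (lB w)
    c-on-lC : ∀ {u l} → u ∈L l → On (c u) (lC l)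

  on : ∀ {x L} → x I L → On x L
  on {L = lP _} (inj₁ refl)        = p-on-lP
  on {L = lP _} (inj₂ (inj₁ refl)) = a-on-lP
  on {L = lP _} (inj₂ (inj₂ refl)) = b-on-lP
  on {L = lA _} (inj₁ refl)        = a-on-lA (inj₁ refl)
  on {L = lA _} (inj₂ (inj₁ refl)) = a-on-lA (inj₂ refl)
  on {L = lA _} (inj₂ (inj₂ refl)) = c-on-lA
  on {L = lB _} (inj₁ refl)        = b-on-lB (inj₁ refl)
  on {L = lB _} (inj₂ (inj₁ refl)) = b-on-lB (inj₂ refl)
  on {L = lB _} (inj₂ (inj₂ refl)) = c-on-lB refl
  on {L = lC _} (inj₁ refl)        = c-on-lC (inj₁ refl)
  on {L = lC _} (inj₂ (inj₁ refl)) = c-on-lC (inj₂ (inj₁ refl))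
  on {L = lC _} (inj₂ (inj₂ refl)) = c-on-lC (inj₂ (inj₂ refl))

  incident : ∀ {x L} → On x L → x I L
  incident p-on-lP = inj₁ refl
  incident a-on-lP = inj₂ (inj₁ refl)
  incident b-on-lP = inj₂ (inj₂ refl)
  incident (a-on-lA i∈u) = Sum.map (cong a) (inj₁ ∘ cong a) i∈u
  incident c-on-lA = inj₂ (inj₂ refl)
  incident (b-on-lB i∈w) = Sum.map (cong b) (inj₁ ∘ cong b) i∈w
  incident (c-on-lB refl) = inj₂ (inj₂ refl)
  incident (c-on-lC u∈l) = Sum.map (cong c) (Sum.map (cong c) (cong c)) u∈l

  c-on-lC⇒∈L : ∀ {u l} → On (c u) (lC l) → u ∈L l
  c-on-lC⇒∈L (c-on-lC u∈l) = u∈l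

  lP∩lC : ∀ {z k l} → On z (lP k) → ¬ On z (lC l)
  lP∩lC () (c-on-lC _)

  lA∩lB : ∀ {z u w} → On z (lA u) → On z (lB w) → from w ≡ u
  lA∩lB (a-on-lA _) ()
  lA∩lB c-on-lA (c-on-lB from-w≡u) = from-w≡u

  lA∩lC : ∀ {z u l} → On z (lA u) → On z (lC l) → u ∈L l
  lA∩lC (a-on-lA _) ()
  lA∩lC c-on-lA (c-on-lC u∈l) = u∈l

  lB∩lC : ∀ {z w l} → On z (lB w) → On z (lC l) → from w ∈L l
  lB∩lC (b-on-lB _) ()
  lB∩lC (c-on-lB refl) (c-on-lC u∈l) = u∈l

  p-on⇒lP : ∀ {L} → On p L → ∃ λ k → L ≡ lP k
  p-on⇒lP p-on-lP = _ , refl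

  a-b-on⇒≡ : ∀ {L i j} → On (a i) L → On (b j) L → i ≡ j
  a-b-on⇒≡ a-on-lP b-on-lP = refl
  a-b-on⇒≡ (a-on-lA _) ()

  c-a-on⇒∈₂ : ∀ {L u i} → On (c u) L → On (a i) L → i ∈₂ u
  c-a-on⇒∈₂ c-on-lA (a-on-lA i∈u) = i∈u
  c-a-on⇒∈₂ (c-on-lB _) ()
  c-a-on⇒∈₂ (c-on-lC _) ()

  c-b-on⇒∈₂to : ∀ {L u i} → On (c u) L → On (b i) L → i ∈₂ to u
  c-b-on⇒∈₂to c-on-lA ()
  c-b-on⇒∈₂to {i = i} (c-on-lB refl) (b-on-lB i∈w) = subst (i ∈₂_) (sym (to-from _)) i∈w
  c-b-on⇒∈₂to (c-on-lC _) ()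

  c-c-on⇒lC : ∀ {L u v} → On (c u) L → On (c v) L → u ≢ v → Σ (Fin (n C 3)) λ l → L ≡ lC l × u ∈L l
  c-c-on⇒lC c-on-lA c-on-lA u≢v = ⊥-elim (u≢v refl)
  c-c-on⇒lC (c-on-lB refl) (c-on-lB refl) u≢v = ⊥-elim (u≢v refl)
  c-c-on⇒lC (c-on-lC u∈l) (c-on-lC _) _ = _ , refl , u∈l

p∷-covers : ∀ {n} (e : Fin n → Pt n) {x} → x ≡ p ⊎ (Σ (Fin n) λ k → x ≡ e k) → ∃ λ r → (p ∷ e) r ≡ x
p∷-covers e (inj₁ refl) = Fin.zero , refl
p∷-covers e (inj₂ (k , refl)) = Fin.suc k , refl

c∉A* : ∀ {n} {u : P2 n} → ¬ A* (c u)
c∉A* (inj₁ ())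
c∉A* (inj₂ (_ , ()))

c∉B* : ∀ {n} {u : P2 n} → ¬ B* (c u)
c∉B* (inj₁ ())
c∉B* (inj₂ (_ , ()))

clique : ∀ {n} → Fin n → Pt n → Set
clique {n} i x = x ≡ a i ⊎ x ≡ b i ⊎ Σ (P2 n) λ u → i ∈₂ u × x ≡ c u

pattern a∈clique = inj₁ refl
pattern b∈clique = inj₂ (inj₁ refl)
pattern c∈clique u i∈u = inj₂ (inj₂ (u , i∈u , refl))

module _ {n : ℕ} (i : Fin (suc n)) where

  clique-enum : Fin (suc (suc n)) → Pt (suc n)
  clique-enum = a i ∷ b i ∷ c ∘ star i

  clique-enum-covers : ∀ {x} → clique i x → ∃ λ r → clique-enum r ≡ x
  clique-enum-covers a∈clique = Fin.zero , refl
  clique-enum-covers b∈clique = Fin.suc Fin.zero , refl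
  clique-enum-covers (c∈clique u i∈u) = Product.map (Fin.suc ∘ Fin.suc) (cong c) (star-onto i i∈u)

  clique-HasSize : HasSize (clique i) (suc (suc n))
  clique-HasSize = clique-enum , enum-injective , enum-∈ , λ _ → clique-enum-covers
    where
    enum-injective : ∀ r r′ → clique-enum r ≡ clique-enum r′ → r ≡ r′
    enum-injective Fin.zero Fin.zero _ = refl
    enum-injective (Fin.suc Fin.zero) (Fin.suc Fin.zero) _ = refl
    enum-injective (Fin.suc (Fin.suc s)) (Fin.suc (Fin.suc s′)) eq =
      cong (Fin.suc ∘ Fin.suc) (star-injective i s s′ (c-injective eq))
    enum-injective Fin.zero (Fin.suc Fin.zero) ()
    enum-injective Fin.zero (Fin.suc (Fin.suc _)) ()
    enum-injective (Fin.suc Fin.zero) Fin.zero ()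
    enum-injective (Fin.suc Fin.zero) (Fin.suc (Fin.suc _)) ()
    enum-injective (Fin.suc (Fin.suc _)) Fin.zero ()
    enum-injective (Fin.suc (Fin.suc _)) (Fin.suc Fin.zero) ()

    enum-∈ : ∀ r → clique i (clique-enum r)
    enum-∈ Fin.zero = a∈clique
    enum-∈ (Fin.suc Fin.zero) = b∈clique
    enum-∈ (Fin.suc (Fin.suc s)) = c∈clique (star i s) (i∈₂star i s)

-- The permutation σ_Φ

module _ {n : ℕ} (Φ : Perms n) (i : Fin n) where

  σΦ-preserves-star⇔fixes :
    (∀ u → i ∈₂ u → i ∈₂ Inverse.to (σΦ Φ) u) ⇔
    (∀ (j : Fin n) (i<j : toℕ i < toℕ j) → Φ j ⟨$⟩ʳ fromℕ< i<j ≡ fromℕ< i<j)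
  σΦ-preserves-star⇔fixes = mk⇔ fixes preserves
    where
    Fixes : Set
    Fixes = ∀ (j : Fin n) (i<j : toℕ i < toℕ j) → Φ j ⟨$⟩ʳ fromℕ< i<j ≡ fromℕ< i<j

    fixes : (∀ u → i ∈₂ u → i ∈₂ Inverse.to (σΦ Φ) u) → Fixes
    fixes preserved j i<j with preserved ⟨ j , fromℕ< i<j ⟩ (inj₂ (loF-fromℕ< i<j))
    ... | inj₁ i≡j = ⊥-elim (<-irrefl (cong toℕ i≡j) i<j)
    ... | inj₂ i≡lo = toℕ-injective (trans (sym (Equivalence.to ≡loF⇔ i≡lo)) (sym (toℕ-fromℕ< i<j)))

    preserves : Fixes → ∀ u → i ∈₂ u → i ∈₂ Inverse.to (σΦ Φ) u
    preserves _ _ (inj₁ i≡hi) = inj₁ i≡hi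
    preserves fixed ⟨ j , l ⟩ (inj₂ i≡lo) =
      inj₂ (Equivalence.from ≡loF⇔ (trans i~l (cong toℕ (sym φl≡l))))
      where
      i~l : toℕ i ≡ toℕ l
      i~l = Equivalence.to ≡loF⇔ i≡lo

      i<j : toℕ i < toℕ j
      i<j = subst (_< toℕ j) (sym i~l) (toℕ<n l)

      φl≡l : Φ j ⟨$⟩ʳ l ≡ l
      φl≡l = subst (λ l′ → Φ j ⟨$⟩ʳ l′ ≡ l′) (toℕ-injective (trans (toℕ-fromℕ< i<j) i~l)) (fixed j i<j)

-- From a star of 𝔑 to a complete graph in Π

module StarToClique {m : ℕ} (σ : P2 (3 + m) ↔ P2 (3 + m)) (N : Config (3 + m)) (i : Fin (3 + m))
  (star-free : FreelyContains (ConfigStructure N) (i ∈₂_))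
  (σ-preserves-star : ∀ u → i ∈₂ u → i ∈₂ Inverse.to σ u) where
  open Incidence σ N
  open Config N using (_∈L_; meet≤1)
  open FreeGraph (ConfigStructure N) star-free

  data Edge : Set where
    ab : Edge
    ac bc : (u : P2 (3 + m)) → i ∈₂ u → Edge
    cc : (u v : P2 (3 + m)) → i ∈₂ u → i ∈₂ v → u ≢ v → Edge

  end₁ end₂ : Edge → Pt (3 + m)
  end₁ ab = a i
  end₁ (ac _ _) = a i
  end₁ (bc _ _) = b i
  end₁ (cc u _ _ _ _) = c u
  end₂ ab = b i
  end₂ (ac u _) = c u
  end₂ (bc u _) = c u
  end₂ (cc _ v _ _ _) = c v

  line : Edge → PiLine (3 + m)
  line ab = lP i
  line (ac u _) = lA u
  line (bc u _) = lB (to u)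
  line (cc u v _ _ _) = lC (edge-line u v)

  -- The last clause gives the edge a_i b_i; on non-edges join is junk.
  join : Pt (3 + m) → Pt (3 + m) → PiLine (3 + m)
  join (a _) (c u) = lA u
  join (c u) (a _) = lA u
  join (b _) (c u) = lB (to u)
  join (c u) (b _) = lB (to u)
  join (c u) (c v) = lC (edge-line u v)
  join _ _ = lP i

  join-sym : ∀ x y → clique i x → clique i y → x ≢ y → join x y ≡ join y x
  join-sym _ _ a∈clique a∈clique _ = refl
  join-sym _ _ a∈clique b∈clique _ = refl
  join-sym _ _ a∈clique (c∈clique _ _) _ = refl
  join-sym _ _ b∈clique a∈clique _ = refl
  join-sym _ _ b∈clique b∈clique _ = refl
  join-sym _ _ b∈clique (c∈clique _ _) _ = refl
  join-sym _ _ (c∈clique _ _) a∈clique _ = refl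
  join-sym _ _ (c∈clique _ _) b∈clique _ = refl
  join-sym _ _ (c∈clique u i∈u) (c∈clique v i∈v) cu≢cv =
    cong lC (edge-line-sym u v i∈u i∈v (cu≢cv ∘ cong c))

  edge : ∀ {x y} → clique i x → clique i y → x ≢ y →
         Σ Edge λ e → join x y ≡ line e × SamePair x y (end₁ e) (end₂ e)
  edge a∈clique a∈clique a≢a = ⊥-elim (a≢a refl)
  edge a∈clique b∈clique _ = ab , refl , inj₁ (refl , refl)
  edge a∈clique (c∈clique u i∈u) _ = ac u i∈u , refl , inj₁ (refl , refl)
  edge b∈clique a∈clique _ = ab , refl , inj₂ (refl , refl)
  edge b∈clique b∈clique b≢b = ⊥-elim (b≢b refl)
  edge b∈clique (c∈clique u i∈u) _ = bc u i∈u , refl , inj₁ (refl , refl)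
  edge (c∈clique u i∈u) a∈clique _ = ac u i∈u , refl , inj₂ (refl , refl)
  edge (c∈clique u i∈u) b∈clique _ = bc u i∈u , refl , inj₂ (refl , refl)
  edge (c∈clique u i∈u) (c∈clique v i∈v) cu≢cv = cc u v i∈u i∈v (cu≢cv ∘ cong c) , refl , inj₁ (refl , refl)

  ends-incident : ∀ e → end₁ e I line e × end₂ e I line e
  ends-incident ab = incident a-on-lP , incident b-on-lP
  ends-incident (ac u i∈u) = incident (a-on-lA i∈u) , incident c-on-lA
  ends-incident (bc u i∈u) = incident (b-on-lB (σ-preserves-star u i∈u)) , incident (c-on-lB (from-to u))
  ends-incident (cc u v i∈u i∈v u≢v) =
    Product.map (incident ∘ c-on-lC) (incident ∘ c-on-lC) (edge-line-incident u v i∈u i∈v u≢v)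

  line-injective : ∀ e e′ → line e ≡ line e′ → SamePair (end₁ e) (end₂ e) (end₁ e′) (end₂ e′)
  line-injective ab ab _ = inj₁ (refl , refl)
  line-injective (ac _ _) (ac _ _) refl = inj₁ (refl , refl)
  line-injective (bc u _) (bc w _) eq = inj₁ (refl , cong c (to-injective (lB-injective eq)))
    where
    lB-injective : ∀ {u w} → lB u ≡ lB w → u ≡ w
    lB-injective refl = refl
    to-injective : ∀ {u w} → to u ≡ to w → u ≡ w
    to-injective {u} {w} eq = trans (sym (from-to u)) (trans (cong from eq) (from-to w))
  line-injective (cc u v i∈u i∈v u≢v) (cc u′ v′ i∈u′ i∈v′ u′≢v′) eq =
    SamePair-map c (edge-line-injective u v u′ v′ i∈u i∈v i∈u′ i∈v′ u≢v u′≢v′ (lC-injective eq))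
    where
    lC-injective : ∀ {l l′} → lC l ≡ lC l′ → l ≡ l′
    lC-injective refl = refl
  line-injective ab (ac _ _) ()
  line-injective ab (bc _ _) ()
  line-injective ab (cc _ _ _ _ _) ()
  line-injective (ac _ _) ab ()
  line-injective (ac _ _) (bc _ _) ()
  line-injective (ac _ _) (cc _ _ _ _ _) ()
  line-injective (bc _ _) ab ()
  line-injective (bc _ _) (ac _ _) ()
  line-injective (bc _ _) (cc _ _ _ _ _) ()
  line-injective (cc _ _ _ _ _) ab ()
  line-injective (cc _ _ _ _ _) (ac _ _) ()
  line-injective (cc _ _ _ _ _) (bc _ _) ()

  lines-meet⇒¬Disjoint : ∀ e e′ {z} → On z (line e) → On z (line e′) →
                         ¬ Disjoint (end₁ e) (end₂ e) (end₁ e′) (end₂ e′)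
  lines-meet⇒¬Disjoint ab ab _ _ (n₁ , _) = n₁ refl
  lines-meet⇒¬Disjoint ab (ac _ _) _ _ (n₁ , _) = n₁ refl
  lines-meet⇒¬Disjoint ab (bc _ _) _ _ (_ , _ , n₃ , _) = n₃ refl
  lines-meet⇒¬Disjoint ab (cc _ _ _ _ _) z∈P z∈C _ = lP∩lC z∈P z∈C
  lines-meet⇒¬Disjoint (ac _ _) ab _ _ (n₁ , _) = n₁ refl
  lines-meet⇒¬Disjoint (ac _ _) (ac _ _) _ _ (n₁ , _) = n₁ refl
  lines-meet⇒¬Disjoint (ac u _) (bc w _) z∈A z∈B (_ , _ , _ , n₄) =
    n₄ (cong c (trans (sym (lA∩lB z∈A z∈B)) (from-to w)))
  lines-meet⇒¬Disjoint (ac w i∈w) (cc u v i∈u i∈v u≢v) z∈A z∈C (_ , _ , n₃ , n₄) =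
    third-vertex-not-on-edge-line (meet≤1) i∈u i∈v i∈w u≢v (n₃ ∘ cong c) (n₄ ∘ cong c) (lA∩lC z∈A z∈C)
  lines-meet⇒¬Disjoint (bc _ _) ab _ _ (_ , n₂ , _) = n₂ refl
  lines-meet⇒¬Disjoint (bc u _) (ac w _) z∈B z∈A (_ , _ , _ , n₄) =
    n₄ (cong c (trans (sym (from-to u)) (lA∩lB z∈A z∈B)))
  lines-meet⇒¬Disjoint (bc _ _) (bc _ _) _ _ (n₁ , _) = n₁ refl
  lines-meet⇒¬Disjoint (bc w i∈w) (cc u v i∈u i∈v u≢v) z∈B z∈C (_ , _ , n₃ , n₄) =
    third-vertex-not-on-edge-line (meet≤1) i∈u i∈v i∈w u≢v (n₃ ∘ cong c) (n₄ ∘ cong c)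
      (subst (_∈L edge-line u v) (from-to w) (lB∩lC z∈B z∈C))
  lines-meet⇒¬Disjoint (cc _ _ _ _ _) ab z∈C z∈P _ = lP∩lC z∈P z∈C
  lines-meet⇒¬Disjoint (cc u v i∈u i∈v u≢v) (ac w i∈w) z∈C z∈A (_ , n₂ , _ , n₄) =
    third-vertex-not-on-edge-line (meet≤1) i∈u i∈v i∈w u≢v (n₂ ∘ cong c ∘ sym) (n₄ ∘ cong c ∘ sym)
      (lA∩lC z∈A z∈C)
  lines-meet⇒¬Disjoint (cc u v i∈u i∈v u≢v) (bc w i∈w) z∈C z∈B (_ , n₂ , _ , n₄) =
    third-vertex-not-on-edge-line (meet≤1) i∈u i∈v i∈w u≢v (n₂ ∘ cong c ∘ sym) (n₄ ∘ cong c ∘ sym)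
      (subst (_∈L edge-line u v) (from-to w) (lB∩lC z∈B z∈C))
  lines-meet⇒¬Disjoint (cc u v i∈u i∈v u≢v) (cc u′ v′ i∈u′ i∈v′ u′≢v′) (c-on-lC z∈l) (c-on-lC z∈l′) disjoint =
    edge-lines-disjoint u v u′ v′ i∈u i∈v i∈u′ i∈v′ u≢v u′≢v′ (Disjoint-map⁻¹ c disjoint) _ z∈l z∈l′

  clique-free : FreelyContains (Π σ N) (clique i)
  clique-free = FreelyContains-by-edges (Π σ N) end₁ end₂ line join join-sym edge ends-incident line-injective
                  (λ e e′ disjoint z z∈e z∈e′ → lines-meet⇒¬Disjoint e e′ (on z∈e) (on z∈e′) disjoint)

  module _ (G : Pt (3 + m) → Set) (G≐clique : G ≐ clique i) where

    c∈G : G (c (star i Fin.zero))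
    c∈G = proj₂ (G≐clique _) (c∈clique _ (i∈₂star i Fin.zero))

    free-clique : HasSize G (4 + m) × FreelyContains (Π σ N) G × ¬ (G ≐ A*) × ¬ (G ≐ B*)
    free-clique =
      HasSize-resp-≐ (λ x → Product.swap (G≐clique x)) (clique-HasSize i) ,
      FreelyContains-⊆ (Π σ N) (λ {x} → proj₁ (G≐clique x)) clique-free ,
      (λ G≐A* → c∉A* (proj₁ (G≐A* _) c∈G)) ,
      (λ G≐B* → c∉B* (proj₁ (G≐B* _) c∈G))

-- From a complete graph in Π to a star of 𝔑

module CliqueToStar {m : ℕ} (σ : P2 (3 + m) ↔ P2 (3 + m)) (N : Config (3 + m))
  (G : Pt (3 + m) → Set) (size : HasSize G (4 + m)) (free : FreelyContains (Π σ N) G) where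
  open Incidence σ N
  open Config N using (degree)
  open FreeGraph (Π σ N) free

  G? : Decidable G
  G? = HasSize⇒decidable _≟ₚ_ size

  joined : ∀ {x y} → G x → G y → x ≢ y → On x (edge-line x y) × On y (edge-line x y)
  joined x∈G y∈G x≢y = Product.map on on (edge-line-incident _ _ x∈G y∈G x≢y)

  a-b∈G⇒≡ : ∀ {i j} → G (a i) → G (b j) → i ≡ j
  a-b∈G⇒≡ ai∈G bj∈G = uncurry a-b-on⇒≡ (joined ai∈G bj∈G λ ())

  p-edge-line : ∀ {y} → G p → G y → y ≢ p → ∃ λ k → edge-line p y ≡ lP k × On y (lP k)
  p-edge-line p∈G y∈G y≢p with joined p∈G y∈G (≢-sym y≢p)
  ... | p-on , y-on with p-on⇒lP p-on
  ...   | k , line≡ = k , line≡ , subst (On _) line≡ y-on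

  p∈G⇒¬a∧b : ∀ {i j} → G p → G (a i) → ¬ G (b j)
  p∈G⇒¬a∧b {i} p∈G ai∈G bj∈G with a-b∈G⇒≡ ai∈G bj∈G
  ... | refl with p-edge-line p∈G ai∈G (λ ()) | p-edge-line p∈G bj∈G (λ ())
  ...   | _ , pa≡ , a-on-lP | _ , pb≡ , b-on-lP
    with edge-line-injective p (a i) p (b i) p∈G ai∈G p∈G bj∈G (λ ()) (λ ()) (trans pa≡ (sym pb≡))
  ...     | inj₁ (_ , ())
  ...     | inj₂ (() , _)

  p∈G⇒⊆A*∪B* : G p → ∀ y → G y → A* y ⊎ B* y
  p∈G⇒⊆A*∪B* p∈G y y∈G with y ≟ₚ p
  ... | yes y≡p = inj₁ (inj₁ y≡p)
  ... | no y≢p with p-edge-line p∈G y∈G y≢p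
  ...   | _ , _ , p-on-lP = inj₁ (inj₁ refl)
  ...   | k , _ , a-on-lP = inj₁ (inj₂ (k , refl))
  ...   | k , _ , b-on-lP = inj₂ (inj₂ (k , refl))

  p∈G⇒A*⊎B* : G p → G ≐ A* ⊎ G ≐ B*
  p∈G⇒A*⊎B* p∈G with any? (G? ∘ a)
  ... | yes (i , ai∈G) = inj₁ (⊆∧covered⇒≐ size (p ∷ a) (λ _ → p∷-covers a) G⊆A*)
    where
    G⊆A* : ∀ y → G y → A* y
    G⊆A* y y∈G with p∈G⇒⊆A*∪B* p∈G y y∈G
    ... | inj₁ y∈A* = y∈A*
    ... | inj₂ (inj₁ y≡p) = inj₁ y≡p
    ... | inj₂ (inj₂ (j , refl)) = ⊥-elim (p∈G⇒¬a∧b p∈G ai∈G y∈G)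
  ... | no no-a = inj₂ (⊆∧covered⇒≐ size (p ∷ b) (λ _ → p∷-covers b) G⊆B*)
    where
    G⊆B* : ∀ y → G y → B* y
    G⊆B* y y∈G with p∈G⇒⊆A*∪B* p∈G y y∈G
    ... | inj₂ y∈B* = y∈B*
    ... | inj₁ (inj₁ y≡p) = inj₁ y≡p
    ... | inj₁ (inj₂ (j , refl)) = ⊥-elim (no-a (j , y∈G))

  module _ (p∉G : ¬ G p) where

    a∈G⇒b∈G : ∀ {i} → G (a i) → ¬ ¬ G (b i)
    a∈G⇒b∈G {i} ai∈G bi∉G = 1+n≰n (edge-lines-covered⇒≤ size ai∈G (lA ∘ star i) covered)
      where
      lines-at-a : ∀ {L y} → On (a i) L → On y L → G y → y ≢ a i → ∃ λ s → lA (star i s) ≡ L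
      lines-at-a a-on-lP p-on-lP p∈G _ = ⊥-elim (p∉G p∈G)
      lines-at-a a-on-lP a-on-lP _ ai≢ai = ⊥-elim (ai≢ai refl)
      lines-at-a a-on-lP b-on-lP bi∈G _ = ⊥-elim (bi∉G bi∈G)
      lines-at-a (a-on-lA i∈u) _ _ _ = Product.map₂ (cong lA) (star-onto i i∈u)

      covered : ∀ y → G y → y ≢ a i → a i I edge-line (a i) y → y I edge-line (a i) y →
                ∃ λ s → lA (star i s) ≡ edge-line (a i) y
      covered y y∈G y≢ai ai-on y-on = lines-at-a (on ai-on) (on y-on) y∈G y≢ai

    b∈G⇒a∈G : ∀ {i} → G (b i) → ¬ ¬ G (a i)
    b∈G⇒a∈G {i} bi∈G ai∉G = 1+n≰n (edge-lines-covered⇒≤ size bi∈G (lB ∘ star i) covered)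
      where
      lines-at-b : ∀ {L y} → On (b i) L → On y L → G y → y ≢ b i → ∃ λ s → lB (star i s) ≡ L
      lines-at-b b-on-lP p-on-lP p∈G _ = ⊥-elim (p∉G p∈G)
      lines-at-b b-on-lP a-on-lP ai∈G _ = ⊥-elim (ai∉G ai∈G)
      lines-at-b b-on-lP b-on-lP _ bi≢bi = ⊥-elim (bi≢bi refl)
      lines-at-b (b-on-lB i∈w) _ _ _ = Product.map₂ (cong lB) (star-onto i i∈w)

      covered : ∀ y → G y → y ≢ b i → b i I edge-line (b i) y → y I edge-line (b i) y →
                ∃ λ s → lB (star i s) ≡ edge-line (b i) y
      covered y y∈G y≢bi bi-on y-on = lines-at-b (on bi-on) (on y-on) y∈G y≢bi

    module _ (no-a : ∀ i → ¬ G (a i)) (no-b : ∀ i → ¬ G (b i)) where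

      vertex-is-c : ∀ {y} → G y → Σ (P2 (3 + m)) λ u → y ≡ c u
      vertex-is-c {p} p∈G = ⊥-elim (p∉G p∈G)
      vertex-is-c {a i} ai∈G = ⊥-elim (no-a i ai∈G)
      vertex-is-c {b i} bi∈G = ⊥-elim (no-b i bi∈G)
      vertex-is-c {c u} _ = u , refl

      only-c⇒⊥ : ⊥
      only-c⇒⊥ with vertex-is-c (proj₁ (proj₂ (proj₂ size)) Fin.zero)
      ... | u , v₀≡cu = 3+m≰1+m (edge-lines-covered⇒≤ size cu∈G (lC ∘ proj₁ (degree u)) covered)
        where
        cu∈G : G (c u)
        cu∈G = subst G v₀≡cu (proj₁ (proj₂ (proj₂ size)) Fin.zero)

        3+m≰1+m : ¬ 3 + m ≤ 1 + m
        3+m≰1+m 3+m≤1+m = 1+n≰n (≤-trans (n≤1+n _) (s≤s⁻¹ 3+m≤1+m))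

        covered : ∀ y → G y → y ≢ c u → c u I edge-line (c u) y → y I edge-line (c u) y →
                  ∃ λ r → lC (proj₁ (degree u) r) ≡ edge-line (c u) y
        covered y y∈G y≢cu cu-on y-on with vertex-is-c y∈G
        ... | u′ , refl with c-c-on⇒lC (on cu-on) (on y-on) (y≢cu ∘ cong c ∘ sym)
        ...   | l , line≡ , u∈l =
          Product.map₂ (λ deg≡l → trans (cong lC deg≡l) (sym line≡)) (proj₂ (proj₂ (proj₂ (degree u))) l u∈l)

    module _ {i : Fin (3 + m)} (ai∈G : G (a i)) (bi∈G : G (b i)) where

      G⊆clique : ∀ y → G y → clique i y
      G⊆clique p p∈G = ⊥-elim (p∉G p∈G)
      G⊆clique (a k) ak∈G = inj₁ (cong a (a-b∈G⇒≡ ak∈G bi∈G))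
      G⊆clique (b k) bk∈G = inj₂ (inj₁ (cong b (sym (a-b∈G⇒≡ ai∈G bk∈G))))
      G⊆clique (c u) cu∈G = c∈clique u (uncurry c-a-on⇒∈₂ (joined cu∈G ai∈G λ ()))

      G≐clique : G ≐ clique i
      G≐clique = ⊆∧covered⇒≐ size (clique-enum i) (λ _ → clique-enum-covers i) G⊆clique

      c∈G : ∀ {u} → i ∈₂ u → G (c u)
      c∈G i∈u = proj₂ (G≐clique _) (c∈clique _ i∈u)

      σ-preserves-star : ∀ u → i ∈₂ u → i ∈₂ to u
      σ-preserves-star u i∈u = uncurry c-b-on⇒∈₂to (joined (c∈G i∈u) bi∈G λ ())

      star-free : FreelyContains (ConfigStructure N) (i ∈₂_)
      star-free = FreelyContains-pullback (ConfigStructure N) (Π σ N) c lC label c-injective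
                    (incident ∘ c-on-lC) (c-on-lC⇒∈L ∘ on) c∈G free through-lC
        where
        -- Only applied to lines lC l, since edges between points c_u lie on such lines.
        label : PiLine (3 + m) → Fin ((3 + m) C 3)
        label (lC l) = l
        label _ = proj₁ (degree (star i Fin.zero)) Fin.zero

        through-lC : ∀ u v → i ∈₂ u → i ∈₂ v → u ≢ v → lC (label (edge-line (c u) (c v))) ≡ edge-line (c u) (c v)
        through-lC u v i∈u i∈v u≢v with uncurry c-c-on⇒lC (joined (c∈G i∈u) (c∈G i∈v) (u≢v ∘ c-injective)) u≢v
        ... | _ , line≡ , _ = trans (cong (lC ∘ label) line≡) (sym line≡)

  star-of-free-clique : ¬ (G ≐ A*) → ¬ (G ≐ B*) →
    Σ (Fin (3 + m)) λ i →
      FreelyContains (ConfigStructure N) (i ∈₂_) × (∀ u → i ∈₂ u → i ∈₂ to u) × G ≐ clique i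
  star-of-free-clique G≢A* G≢B* with G? p
  ... | yes p∈G = ⊥-elim ([ G≢A* , G≢B* ] (p∈G⇒A*⊎B* p∈G))
  ... | no p∉G with any? (G? ∘ a)
  ...   | yes (i , ai∈G) =
    i , star-free p∉G ai∈G bi∈G , σ-preserves-star p∉G ai∈G bi∈G , G≐clique p∉G ai∈G bi∈G
    where
    bi∈G : G (b i)
    bi∈G = decidable-stable (G? (b i)) (a∈G⇒b∈G p∉G ai∈G)
  ...   | no no-a with any? (G? ∘ b)
  ...     | yes (j , bj∈G) = ⊥-elim (b∈G⇒a∈G p∉G bj∈G (no-a ∘ (j ,_)))
  ...     | no no-b = ⊥-elim (only-c⇒⊥ p∉G (λ i → no-a ∘ (i ,_)) (λ i → no-b ∘ (i ,_)))

proposition2p7 : (n : ℕ) → 3 ≤ n → (Φ : Perms n) → (N : Config n) → (G : Pt n → Set) →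
    (HasSize G (suc n)
      × FreelyContains (Π (σΦ Φ) N) G
      × ¬ (G ≐ A*)
      × ¬ (G ≐ B*))
    ⇔
    (Σ (Fin n) λ i₀ →
        FreelyContains (ConfigStructure N) (λ u → i₀ ∈₂ u)
      × (∀ (j : Fin n) (lt : toℕ i₀ < toℕ j) → Φ j ⟨$⟩ʳ fromℕ< lt ≡ fromℕ< lt)
      × (G ≐ λ x → x ≡ a i₀ ⊎ x ≡ b i₀ ⊎ Σ (P2 n) λ u → i₀ ∈₂ u × x ≡ c u))
proposition2p7 (suc (suc (suc m))) (s≤s (s≤s (s≤s _))) Φ N G = mk⇔
  (λ (size , free , G≢A* , G≢B*) →
     let i , star-free , preserves , G≐clique = CliqueToStar.star-of-free-clique (σΦ Φ) N G size free G≢A* G≢B*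
     in i , star-free , Equivalence.to (σΦ-preserves-star⇔fixes Φ i) preserves , G≐clique)
  (λ (i , star-free , fixes , G≐clique) →
     StarToClique.free-clique (σΦ Φ) N i star-free (Equivalence.from (σΦ-preserves-star⇔fixes Φ i) fixes) G G≐clique)
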